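{- Let $T_\infty$ be the infinite rooted binary tree with root $x_0$, fix a labeling of $T_\infty$, and fix an integer $\ell\geq 2$. Then $\widetilde{M}_{\ell}$ and $M_{\ell}$ are subgroups of $\operatorname{Aut}(T_\infty)$.
   Context: A labeling of $T_\infty$ assigns to each node at level $m$ a word in $\{0,1\}^m$ (the root gets the empty word), bijectively on each level, so that the two children of the node labeled $w$ are labeled $w0$ and $w1$. For $\sigma\in\operatorname{Aut}(T_\infty)$ (automorphisms of the rooted tree), a node $y$ and $m\geq 1$: $\sigma$ sends the node labeled $ys_1\dots s_m$ to the node labeled $\sigma(y)t_1\dots t_m$, and $\operatorname{sgn}_m(\sigma,y)\in\{\pm1\}$ is the sign of the permutation $(s_1,\dots,s_m)\mapsto(t_1,\dots,t_m)$ of $\{0,1\}^m$. $\widetilde{M}_\ell$ is the set of $\sigma\in\operatorname{Aut}(T_\infty)$ with $\operatorname{sgn}_\ell(\sigma,y)=\operatorname{sgn}_\ell(\sigma,x_0)$ for every node $y$; $M_\ell$ is the set of $\sigma\in\widetilde{M}_\ell$ for which $\operatorname{sgn}_\ell(\sigma,x_0)=+1$. -}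

module Defs where

open import Data.Bool using (Bool; true; false; if_then_else_; _∧_)
open import Data.Nat using (ℕ; zero; suc; _+_; _*_; _<ᵇ_; _%_; _≥_)
open import Data.List using (List; []; _∷_; [_]; _++_; length; drop; map; concatMap)
open import Data.Nat.ListAction using (sum)
open import Data.Product using (∃; Σ; _×_; _,_)
open import Data.Sign using (Sign)
open import Relation.Binary.PropositionalEquality using (_≡_)

-- Words over {0,1} (false = 0, true = 1).
Word : Set
Word = List Bool

-- The infinite rooted binary tree T∞ is modelled concretely: its nodes are
-- finite Bool-lists, the root x₀ is [], and the children of a node v are
-- v ++ [ false ] and v ++ [ true ].  (This concrete model is independent of
-- the labeling, which is an arbitrary extra datum, see Labeling below.)
Node : Set
Node = List Bool

root : Node
root = []

Child : Node → Node → Set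
Child u v = ∃ λ b → u ≡ v ++ [ b ]

record Aut : Set where
  field
    fun      : Node → Node
    inv      : Node → Node
    inv-fun  : ∀ v → inv (fun v) ≡ v
    fun-inv  : ∀ v → fun (inv v) ≡ v
    fun-root : fun root ≡ root
    fun-child : ∀ u v → Child u v → Child (fun u) (fun v)
    inv-child : ∀ u v → Child u v → Child (inv u) (inv v)
open Aut public

idAut : Aut
idAut = record
  { fun = λ v → v ; inv = λ v → v
  ; inv-fun = λ v → Relation.Binary.PropositionalEquality.refl
  ; fun-inv = λ v → Relation.Binary.PropositionalEquality.refl
  ; fun-root = Relation.Binary.PropositionalEquality.refl
  ; fun-child = λ u v c → c ; inv-child = λ u v c → c }

_∘ᴬ_ : Aut → Aut → Aut
σ ∘ᴬ τ = record
  { fun = λ v → fun σ (fun τ v)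
  ; inv = λ v → inv τ (inv σ v)
  ; inv-fun = λ v → Relation.Binary.PropositionalEquality.trans
                      (Relation.Binary.PropositionalEquality.cong (inv τ) (inv-fun σ (fun τ v)))
                      (inv-fun τ v)
  ; fun-inv = λ v → Relation.Binary.PropositionalEquality.trans
                      (Relation.Binary.PropositionalEquality.cong (fun σ) (fun-inv τ (inv σ v)))
                      (fun-inv σ v)
  ; fun-root = Relation.Binary.PropositionalEquality.trans
                 (Relation.Binary.PropositionalEquality.cong (fun σ) (fun-root τ))
                 (fun-root σ)
  ; fun-child = λ u v c → fun-child σ _ _ (fun-child τ u v c)
  ; inv-child = λ u v c → inv-child τ _ _ (inv-child σ u v c) }

_⁻¹ᴬ : Aut → Aut
σ ⁻¹ᴬ = record
  { fun = inv σ ; inv = fun σ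
  ; inv-fun = fun-inv σ ; fun-inv = inv-fun σ
  ; fun-root = Relation.Binary.PropositionalEquality.trans
                 (Relation.Binary.PropositionalEquality.cong (inv σ)
                   (Relation.Binary.PropositionalEquality.sym (fun-root σ)))
                 (inv-fun σ root)
  ; fun-child = inv-child σ ; inv-child = fun-child σ }

-- A labeling of T∞: a bijection lab from nodes to words, mapping level m
-- onto {0,1}^m, such that the two children of the node labeled w are
-- labeled w0 and w1 (i.e. each child of v is labeled (lab v) followed by a bit).
record Labeling : Set where
  field
    lab       : Node → Word
    unlab     : Word → Node
    unlab-lab : ∀ v → unlab (lab v) ≡ v
    lab-unlab : ∀ w → lab (unlab w) ≡ w
    lab-level : ∀ v → length (lab v) ≡ length v
    lab-child : ∀ v b → ∃ λ b' → lab (v ++ [ b ]) ≡ lab v ++ [ b' ]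
open Labeling public

words : ℕ → List Word
words zero = [ [] ]
words (suc m) = concatMap (λ w → (false ∷ w) ∷ (true ∷ w) ∷ []) (words m)

-- Binary value of a word (a fixed injective enumeration of {0,1}^m).
val : Word → ℕ
val [] = 0
val (false ∷ w) = 2 * val w
val (true ∷ w) = suc (2 * val w)

inversions : ℕ → (Word → Word) → ℕ
inversions m f =
  sum (concatMap (λ s → map (λ s' →
         if (val s <ᵇ val s') ∧ (val (f s') <ᵇ val (f s)) then 1 else 0)
       (words m)) (words m))

signPerm : ℕ → (Word → Word) → Sign
signPerm m f with inversions m f % 2
... | zero = Sign.+
... | suc _ = Sign.-

-- sgn_m(σ, y): σ sends the node labeled  y s₁…s_m  (here "y" stands for the
-- label of node y) to the node labeled σ(y) t₁…t_m; this is the sign of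
-- s ↦ t on {0,1}^m.
sgn : Labeling → ℕ → Aut → Node → Sign
sgn L m σ y =
  signPerm m (λ s → drop (length y) (lab L (fun σ (unlab L (lab L y ++ s)))))

InMtilde : Labeling → ℕ → Aut → Set
InMtilde L ℓ σ = ∀ (y : Node) → sgn L ℓ σ y ≡ sgn L ℓ σ root

InM : Labeling → ℕ → Aut → Set
InM L ℓ σ = InMtilde L ℓ σ × (sgn L ℓ σ root ≡ Sign.+)

IsSubgroup : (Aut → Set) → Set
IsSubgroup H =
  H idAut × (∀ σ τ → H σ → H τ → H (σ ∘ᴬ τ)) × (∀ σ → H σ → H (σ ⁻¹ᴬ))

-- The sign sgn_m(σ, y) is a cocycle: sgn_m(στ, y) = sgn_m(τ, y) · sgn_m(σ, τ y), because the
-- permutation that στ induces on the m-th level below y is the composite of the one τ induces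
-- below y with the one σ induces below τ y, and the sign of a permutation is multiplicative.
-- So if sgn_m(σ, ·) and sgn_m(τ, ·) are constant, so is sgn_m(στ, ·), with the product as its
-- value; and sgn_m(σ⁻¹, y) = sgn_m(σ, σ⁻¹ y) handles inverses.  Multiplicativity of the sign,
-- defined here through the parity of the number of inversions, comes from counting: g ∘ f
-- inverts a pair exactly when one of f and g (on the image pair) does, so
-- inv (g ∘ f) + 2 · (pairs inverted by both) = inv f + inv g.
module Submission where

open import Defs
open import Data.Bool using (Bool; true; false; not; _∧_; if_then_else_; T)
open import Data.Bool.Properties using (¬-not)
import Data.Bool as Bool
open import Data.Nat using (ℕ; zero; suc; _+_; _*_; _<ᵇ_; _%_; _≥_; _≟_)
open import Relation.Nullary using (yes; no)
open import Data.Nat.Properties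
  using (+-commutativeSemigroup; suc-injective; even≢odd; +-comm; +-identityʳ; +-cancelˡ-≡; *-identityˡ; *-zeroʳ; *-distribˡ-+; *-distribʳ-+; *-cancelˡ-≡; <ᵇ⇒<; <⇒≢)
open import Data.Nat.ListAction using (sum)
open import Data.Nat.ListAction.Properties using (sum-++; sum-↭)
open import Data.List using (List; []; _∷_; [_]; _++_; length; drop; map; concatMap)
open import Data.List.Properties using (map-∘; ++-assoc; ++-identityʳ; ++-cancelˡ; length-++)
open import Data.List.Membership.Propositional using (_∈_; find; lose)
open import Data.List.Membership.Propositional.Properties using (∈-map⁺; ∈-map⁻; ∈-concatMap⁺; ∈-concatMap⁻)
open import Data.List.Membership.Propositional.Properties.WithK using (unique∧set⇒bag)
open import Data.List.Relation.Unary.Any using (here; there)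
open import Data.List.Relation.Unary.Unique.Propositional using (Unique)
import Data.List.Relation.Unary.Unique.Propositional.Properties as Unique
open import Data.List.Relation.Binary.Permutation.Propositional using (_↭_)
open import Data.List.Relation.Binary.Disjoint.Propositional using (Disjoint)
import Data.List.Relation.Unary.All as All
import Data.List.Relation.Unary.All.Properties as All
import Data.List.Relation.Unary.AllPairs as AllPairs
import Data.List.Relation.Unary.AllPairs.Properties as AllPairs
import Data.List.Relation.Binary.Permutation.Propositional.Properties as ↭
open import Data.List.Relation.Binary.BagAndSetEquality using (∼bag⇒↭)
open import Data.Product using (∃; _×_; _,_)
open import Data.Sign as Sign using (Sign)
import Data.Sign.Properties as Signₚ
open import Algebra.Properties.CommutativeSemigroup +-commutativeSemigroup using (interchange)
open import Data.Unit using (tt)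
open import Function using (_∘_; id; mk⇔)
open import Level using (Level)
open import Relation.Nullary using (contradiction)
open import Relation.Binary.PropositionalEquality hiding ([_])

private
  variable
    a : Level
    A : Set a

parity : ℕ → Sign
parity zero = Sign.+
parity (suc n) = Sign.opposite (parity n)

parity-+ : ∀ m n → parity (m + n) ≡ parity m Sign.* parity n
parity-+ zero n = refl
parity-+ (suc m) n =
  trans (cong Sign.opposite (parity-+ m n)) (sym (Signₚ.*-assoc Sign.- (parity m) (parity n)))

parity-double : ∀ n → parity (2 * n) ≡ Sign.+
parity-double n = begin
  parity (n + (n + 0))       ≡⟨ cong (λ k → parity (n + k)) (+-identityʳ n) ⟩
  parity (n + n)             ≡⟨ parity-+ n n ⟩
  parity n Sign.* parity n   ≡⟨ Signₚ.s*s≡+ (parity n) ⟩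
  Sign.+                     ∎
  where open ≡-Reasoning

∑ : List A → (A → ℕ) → ℕ
∑ xs h = sum (map h xs)

∑-cong : ∀ xs {h h′ : A → ℕ} → (∀ {x} → x ∈ xs → h x ≡ h′ x) → ∑ xs h ≡ ∑ xs h′
∑-cong []       eq = refl
∑-cong (x ∷ xs) eq = cong₂ _+_ (eq (here refl)) (∑-cong xs (eq ∘ there))

∑-zero : ∀ (xs : List A) → ∑ xs (λ _ → 0) ≡ 0
∑-zero []       = refl
∑-zero (x ∷ xs) = ∑-zero xs

∑-+ : ∀ xs (h h′ : A → ℕ) → ∑ xs (λ x → h x + h′ x) ≡ ∑ xs h + ∑ xs h′
∑-+ []       h h′ = refl
∑-+ (x ∷ xs) h h′ =
  trans (cong (h x + h′ x +_) (∑-+ xs h h′)) (interchange (h x) (h′ x) (∑ xs h) (∑ xs h′))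

∑-* : ∀ xs k (h : A → ℕ) → ∑ xs (λ x → k * h x) ≡ k * ∑ xs h
∑-* []       k h = sym (*-zeroʳ k)
∑-* (x ∷ xs) k h =
  trans (cong (k * h x +_) (∑-* xs k h)) (sym (*-distribˡ-+ k (h x) (∑ xs h)))

∑-comm : ∀ (xs ys : List A) (h : A → A → ℕ) →
         ∑ xs (λ x → ∑ ys (h x)) ≡ ∑ ys (λ y → ∑ xs (λ x → h x y))
∑-comm []       ys h = sym (∑-zero ys)
∑-comm (x ∷ xs) ys h =
  trans (cong (∑ ys (h x) +_) (∑-comm xs ys h)) (sym (∑-+ ys (h x) (λ y → ∑ xs (λ x′ → h x′ y))))

∑-↭ : ∀ {xs} (f : A → A) (h : A → ℕ) → map f xs ↭ xs → ∑ xs (h ∘ f) ≡ ∑ xs h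
∑-↭ {xs = xs} f h p = trans (cong sum (map-∘ xs)) (sum-↭ (↭.map⁺ h p))

sum-concatMap : ∀ (g : A → List ℕ) xs → sum (concatMap g xs) ≡ ∑ xs (sum ∘ g)
sum-concatMap g []       = refl
sum-concatMap g (x ∷ xs) = trans (sum-++ (g x) (concatMap g xs)) (cong (sum (g x) +_) (sum-concatMap g xs))

∑² : List A → (A → A → ℕ) → ℕ
∑² W F = ∑ W (λ x → ∑ W (F x))

∑²-cong : ∀ W {F G : A → A → ℕ} → (∀ {x y} → x ∈ W → y ∈ W → F x y ≡ G x y) → ∑² W F ≡ ∑² W G
∑²-cong W eq = ∑-cong W (λ x∈W → ∑-cong W (eq x∈W))

∑²-+ : ∀ W (F G : A → A → ℕ) → ∑² W (λ x y → F x y + G x y) ≡ ∑² W F + ∑² W G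
∑²-+ W F G = trans (∑-cong W (λ {x} _ → ∑-+ W (F x) (G x))) (∑-+ W _ _)

∑²-* : ∀ W k (F : A → A → ℕ) → ∑² W (λ x y → k * F x y) ≡ k * ∑² W F
∑²-* W k F = trans (∑-cong W (λ {x} _ → ∑-* W k (F x))) (∑-* W k _)

∑²-flip : ∀ W (F : A → A → ℕ) → ∑² W (λ x y → F y x) ≡ ∑² W F
∑²-flip W F = ∑-comm W W (λ x y → F y x)

∑²-↭ : ∀ W (f : A → A) (F : A → A → ℕ) → map f W ↭ W → ∑² W (λ x y → F (f x) (f y)) ≡ ∑² W F
∑²-↭ W f F p = trans (∑-cong W (λ {x} _ → ∑-↭ f (F (f x)) p)) (∑-↭ f (λ x → ∑ W (F x)) p)

𝟙 : Bool → ℕ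
𝟙 b = if b then 1 else 0

<ᵇ-irrefl : ∀ n → (n <ᵇ n) ≡ false
<ᵇ-irrefl zero    = refl
<ᵇ-irrefl (suc n) = <ᵇ-irrefl n

<ᵇ-asym : ∀ m n → (m <ᵇ n) ∧ (n <ᵇ m) ≡ false
<ᵇ-asym zero    zero    = refl
<ᵇ-asym zero    (suc n) = refl
<ᵇ-asym (suc m) zero    = refl
<ᵇ-asym (suc m) (suc n) = <ᵇ-asym m n

<ᵇ-flip : ∀ m n → m ≢ n → (n <ᵇ m) ≡ not (m <ᵇ n)
<ᵇ-flip zero    zero    m≢n = contradiction refl m≢n
<ᵇ-flip zero    (suc n) m≢n = refl
<ᵇ-flip (suc m) zero    m≢n = refl
<ᵇ-flip (suc m) (suc n) m≢n = <ᵇ-flip m n (m≢n ∘ cong suc)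

𝟙-+-not : ∀ b → 𝟙 b + 𝟙 (not b) ≡ 1
𝟙-+-not false = refl
𝟙-+-not true  = refl

indicator-identity : ∀ p q →
  𝟙 (not q) + 2 * (𝟙 (not p) * (𝟙 (p ∧ not q) + 𝟙 (not p ∧ q)))
    ≡ 𝟙 (not p) + 1 * (𝟙 (p ∧ not q) + 𝟙 (not p ∧ q))
indicator-identity false false = refl
indicator-identity false true  = refl
indicator-identity true  false = refl
indicator-identity true  true  = refl

<ᵇ⇒≢ : ∀ m n → (m <ᵇ n) ≡ true → m ≢ n
<ᵇ⇒≢ m n m<n = <⇒≢ (<ᵇ⇒< m n (subst T (sym m<n) tt))

inverts : (A → ℕ) → (A → A) → A → A → Bool
inverts key f x y = (key x <ᵇ key y) ∧ (key (f y) <ᵇ key (f x))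

inversionsOn : (A → ℕ) → List A → (A → A) → ℕ
inversionsOn key W f = sum (concatMap (λ x → map (λ y → 𝟙 (inverts key f x y)) W) W)

inversionsOn-∑² : ∀ key W (f : A → A) → inversionsOn key W f ≡ ∑² W (λ x y → 𝟙 (inverts key f x y))
inversionsOn-∑² key W f = sum-concatMap _ W

inversionsOn-cong : ∀ key W {f g : A → A} → f ≗ g → inversionsOn key W f ≡ inversionsOn key W g
inversionsOn-cong key W {f} {g} f≗g = begin
  inversionsOn key W f                          ≡⟨ inversionsOn-∑² key W f ⟩
  ∑² W (λ x y → 𝟙 (inverts key f x y))
    ≡⟨ ∑²-cong W (λ {x} {y} _ _ → cong₂ (λ u v → 𝟙 ((key x <ᵇ key y) ∧ (key u <ᵇ key v))) (f≗g y) (f≗g x)) ⟩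
  ∑² W (λ x y → 𝟙 (inverts key g x y))          ≡⟨ inversionsOn-∑² key W g ⟨
  inversionsOn key W g                          ∎
  where open ≡-Reasoning

inversionsOn-id : ∀ key (W : List A) → inversionsOn key W id ≡ 0
inversionsOn-id key W = begin
  inversionsOn key W id                  ≡⟨ inversionsOn-∑² key W id ⟩
  ∑² W (λ x y → 𝟙 (inverts key id x y))  ≡⟨ ∑²-cong W (λ {x} {y} _ _ → cong 𝟙 (<ᵇ-asym (key x) (key y))) ⟩
  ∑² W (λ _ _ → 0)                       ≡⟨ ∑-cong W (λ _ → ∑-zero W) ⟩
  ∑ W (λ _ → 0)                          ≡⟨ ∑-zero W ⟩
  0                                      ∎
  where open ≡-Reasoning

record Permutes {a} {A : Set a} (W : List A) (f : A → A) : Set a where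
  field
    injective   : ∀ {x y} → f x ≡ f y → x ≡ y
    ∈-preserved : ∀ {x} → x ∈ W → f x ∈ W
    onto        : ∀ {y} → y ∈ W → ∃ λ x → x ∈ W × f x ≡ y

  map-↭ : Unique W → map f W ↭ W
  map-↭ W! = ∼bag⇒↭ (unique∧set⇒bag (Unique.map⁺ injective W!) W! (mk⇔ image⊆W W⊆image))
    where
    image⊆W : ∀ {y} → y ∈ map f W → y ∈ W
    image⊆W y∈ with ∈-map⁻ f y∈
    ... | x , x∈W , refl = ∈-preserved x∈W
    W⊆image : ∀ {y} → y ∈ W → y ∈ map f W
    W⊆image y∈W with onto y∈W
    ... | x , x∈W , refl = ∈-map⁺ f x∈W

module InversionParity (key : A → ℕ) {W : List A} (W! : Unique W)
                       (key-injective : ∀ {x y} → x ∈ W → y ∈ W → key x ≡ key y → x ≡ y) where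

  open Permutes

  private
    ι : (A → A) → A → A → ℕ
    ι f x y = 𝟙 (inverts key f x y)

    before : A → A → ℕ
    before x y = 𝟙 (key x <ᵇ key y)

  keys-distinct : ∀ {f x y} → Permutes W f → x ∈ W → y ∈ W → key x ≢ key y → key (f x) ≢ key (f y)
  keys-distinct f-perm x∈W y∈W kx≢ky eq =
    kx≢ky (cong key (injective f-perm (key-injective (∈-preserved f-perm x∈W) (∈-preserved f-perm y∈W) eq)))

  module _ {f g : A → A} (f-perm : Permutes W f) (g-perm : Permutes W g) where

    flips : A → A → ℕ
    flips x y = ι g x y + ι g y x

    crossings : ℕ
    crossings = ∑² W (λ x y → ι f x y * flips (f x) (f y))

    ordered-images-distinct : ∀ {x y} → x ∈ W → y ∈ W → (key x <ᵇ key y) ≡ true → key (f x) ≢ key (f y)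
    ordered-images-distinct x∈W y∈W x<y = keys-distinct f-perm x∈W y∈W (<ᵇ⇒≢ _ _ x<y)

    -- For x < y, with p (resp. q) saying that f (resp. g ∘ f) keeps x, y in order, g ∘ f inverts
    -- the pair iff exactly one of f and g (on the pair f x, f y) does: an identity in p and q.
    ι-∘ : ∀ {x y} → x ∈ W → y ∈ W →
          ι (g ∘ f) x y + 2 * (ι f x y * flips (f x) (f y)) ≡ ι f x y + before x y * flips (f x) (f y)
    ι-∘ {x} {y} x∈W y∈W with key x <ᵇ key y in x<y
    ... | false = refl
    ... | true
      rewrite <ᵇ-flip (key (f x)) (key (f y)) (ordered-images-distinct x∈W y∈W x<y)
            | <ᵇ-flip (key (g (f x))) (key (g (f y)))
                (keys-distinct g-perm (∈-preserved f-perm x∈W) (∈-preserved f-perm y∈W)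
                  (ordered-images-distinct x∈W y∈W x<y))
      = indicator-identity (key (f x) <ᵇ key (f y)) (key (g (f x)) <ᵇ key (g (f y)))

    flips-sym : ∀ x y → flips x y ≡ flips y x
    flips-sym x y = +-comm (ι g x y) (ι g y x)

    before-connex : ∀ {x y} → x ∈ W → y ∈ W →
                    (before x y + before y x) * flips (f x) (f y) ≡ flips (f x) (f y)
    before-connex {x} {y} x∈W y∈W with key x ≟ key y
    ... | yes kx≡ky with refl ← key-injective x∈W y∈W kx≡ky
      rewrite <ᵇ-irrefl (key x) | <ᵇ-irrefl (key (f x)) = refl
    ... | no kx≢ky rewrite <ᵇ-flip (key x) (key y) kx≢ky =
      trans (cong (_* flips (f x) (f y)) (𝟙-+-not (key x <ᵇ key y))) (*-identityˡ _)

    -- Counting each unordered pair in both orders gives ∑² flips over the f-images, which by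
    -- reindexing along f is twice the number of inversions of g.
    ∑²-before-flips : ∑² W (λ x y → before x y * flips (f x) (f y)) ≡ inversionsOn key W g
    ∑²-before-flips = *-cancelˡ-≡ _ _ 2 (begin
      2 * S                                                            ≡⟨ cong (S +_) (+-identityʳ S) ⟩
      S + S                                                            ≡⟨ cong (S +_) (∑²-flip W _) ⟨
      S + ∑² W (λ x y → before y x * flips (f y) (f x))
        ≡⟨ cong (S +_) (∑²-cong W (λ {x} {y} _ _ → cong (before y x *_) (flips-sym (f y) (f x)))) ⟩
      S + ∑² W (λ x y → before y x * flips (f x) (f y))                ≡⟨ ∑²-+ W _ _ ⟨
      ∑² W (λ x y → before x y * flips (f x) (f y) + before y x * flips (f x) (f y))
        ≡⟨ ∑²-cong W (λ {x} {y} x∈W y∈W →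
             trans (sym (*-distribʳ-+ (flips (f x) (f y)) (before x y) (before y x))) (before-connex x∈W y∈W)) ⟩
      ∑² W (λ x y → flips (f x) (f y))                                 ≡⟨ ∑²-↭ W f flips (map-↭ f-perm W!) ⟩
      ∑² W flips                                                       ≡⟨ ∑²-+ W (ι g) (λ x y → ι g y x) ⟩
      ∑² W (ι g) + ∑² W (λ x y → ι g y x)                              ≡⟨ cong (∑² W (ι g) +_) (∑²-flip W (ι g)) ⟩
      ∑² W (ι g) + ∑² W (ι g)                                          ≡⟨ cong₂ _+_ (inversionsOn-∑² key W g) (inversionsOn-∑² key W g) ⟨
      inversionsOn key W g + inversionsOn key W g                      ≡⟨ cong (inversionsOn key W g +_) (+-identityʳ _) ⟨
      2 * inversionsOn key W g                                         ∎)
      where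
      open ≡-Reasoning
      S : ℕ
      S = ∑² W (λ x y → before x y * flips (f x) (f y))

    inversions-∘ : inversionsOn key W (g ∘ f) + 2 * crossings ≡ inversionsOn key W f + inversionsOn key W g
    inversions-∘ = begin
      inversionsOn key W (g ∘ f) + 2 * crossings
        ≡⟨ cong₂ _+_ (inversionsOn-∑² key W (g ∘ f)) (sym (∑²-* W 2 _)) ⟩
      ∑² W (ι (g ∘ f)) + ∑² W (λ x y → 2 * (ι f x y * flips (f x) (f y)))
        ≡⟨ ∑²-+ W _ _ ⟨
      ∑² W (λ x y → ι (g ∘ f) x y + 2 * (ι f x y * flips (f x) (f y)))
        ≡⟨ ∑²-cong W ι-∘ ⟩
      ∑² W (λ x y → ι f x y + before x y * flips (f x) (f y))
        ≡⟨ ∑²-+ W _ _ ⟩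
      ∑² W (ι f) + ∑² W (λ x y → before x y * flips (f x) (f y))
        ≡⟨ cong₂ _+_ (inversionsOn-∑² key W f) (sym ∑²-before-flips) ⟨
      inversionsOn key W f + inversionsOn key W g
        ∎
      where open ≡-Reasoning

  parity-inversionsOn-∘ : ∀ {f g} → Permutes W f → Permutes W g →
    parity (inversionsOn key W (g ∘ f)) ≡ parity (inversionsOn key W f) Sign.* parity (inversionsOn key W g)
  parity-inversionsOn-∘ {f} {g} f-perm g-perm = begin
    parity I∘                                      ≡⟨ Signₚ.*-identityʳ (parity I∘) ⟨
    parity I∘ Sign.* Sign.+                        ≡⟨ cong (parity I∘ Sign.*_) (parity-double c) ⟨
    parity I∘ Sign.* parity (2 * c)                ≡⟨ parity-+ I∘ (2 * c) ⟨
    parity (I∘ + 2 * c)                            ≡⟨ cong parity (inversions-∘ f-perm g-perm) ⟩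
    parity (inversionsOn key W f + inversionsOn key W g)
                                                   ≡⟨ parity-+ (inversionsOn key W f) (inversionsOn key W g) ⟩
    parity (inversionsOn key W f) Sign.* parity (inversionsOn key W g)
                                                   ∎
    where
    open ≡-Reasoning
    I∘ c : ℕ
    I∘ = inversionsOn key W (g ∘ f)
    c  = crossings f-perm g-perm

extensions : Word → List Word
extensions w = (false ∷ w) ∷ (true ∷ w) ∷ []

∈-words⁻ : ∀ m {x} → x ∈ words m → length x ≡ m
∈-words⁻ zero    (here refl) = refl
∈-words⁻ (suc m) x∈words with find (∈-concatMap⁻ extensions {words m} x∈words)
... | w , w∈words , here refl         = cong suc (∈-words⁻ m w∈words)
... | w , w∈words , there (here refl) = cong suc (∈-words⁻ m w∈words)

∈-words⁺ : ∀ m {x} → length x ≡ m → x ∈ words m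
∈-words⁺ zero    {[]}    refl = here refl
∈-words⁺ (suc m) {b ∷ x} refl = ∈-concatMap⁺ extensions {words m} (lose (∈-words⁺ m refl) (extension b))
  where
  extension : ∀ b → b ∷ x ∈ extensions x
  extension false = here refl
  extension true  = there (here refl)

words-unique : ∀ m → Unique (words m)
words-unique zero    = All.[] AllPairs.∷ AllPairs.[]
words-unique (suc m) = Unique.concat⁺
  (All.map⁺ (All.universal extensions-unique (words m)))
  (AllPairs.map⁺ (AllPairs.map extensions-disjoint (words-unique m)))
  where
  extensions-unique : ∀ w → Unique (extensions w)
  extensions-unique w = ((λ ()) All.∷ All.[]) AllPairs.∷ All.[] AllPairs.∷ AllPairs.[]
  extensions-disjoint : ∀ {w w′} → w ≢ w′ → Disjoint (extensions w) (extensions w′)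
  extensions-disjoint w≢w′ (here refl         , here refl)         = w≢w′ refl
  extensions-disjoint w≢w′ (here refl         , there (here ()))
  extensions-disjoint w≢w′ (there (here refl) , here ())
  extensions-disjoint w≢w′ (there (here refl) , there (here refl)) = w≢w′ refl

val-injective : ∀ {x y} → length x ≡ length y → val x ≡ val y → x ≡ y
val-injective {[]}        {[]}        _  _  = refl
val-injective {false ∷ x} {false ∷ y} eq e = cong (false ∷_) (val-injective (suc-injective eq) (*-cancelˡ-≡ _ _ 2 e))
val-injective {false ∷ x} {true ∷ y}  _  e = contradiction e (even≢odd (val x) (val y))
val-injective {true ∷ x}  {false ∷ y} _  e = contradiction (sym e) (even≢odd (val y) (val x))
val-injective {true ∷ x}  {true ∷ y}  eq e =
  cong (true ∷_) (val-injective (suc-injective eq) (*-cancelˡ-≡ _ _ 2 (suc-injective e)))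

module WordParity (m : ℕ) = InversionParity val (words-unique m)
  (λ x∈words y∈words → val-injective (trans (∈-words⁻ m x∈words) (sym (∈-words⁻ m y∈words))))

remainderSign : ℕ → Sign
remainderSign zero    = Sign.+
remainderSign (suc _) = Sign.-

remainderSign-%2 : ∀ n → remainderSign (n % 2) ≡ parity n
remainderSign-%2 zero          = refl
remainderSign-%2 (suc zero)    = refl
remainderSign-%2 (suc (suc n)) = trans (remainderSign-%2 n) (sym (Signₚ.opposite-involutive (parity n)))

signPerm≡parity : ∀ m f → signPerm m f ≡ parity (inversions m f)
signPerm≡parity m f = trans (signPerm≡remainderSign) (remainderSign-%2 (inversions m f))
  where
  signPerm≡remainderSign : signPerm m f ≡ remainderSign (inversions m f % 2)
  signPerm≡remainderSign with inversions m f % 2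
  ... | zero  = refl
  ... | suc _ = refl

signPerm-cong : ∀ m {f g} → f ≗ g → signPerm m f ≡ signPerm m g
signPerm-cong m {f} {g} f≗g = begin
  signPerm m f               ≡⟨ signPerm≡parity m f ⟩
  parity (inversions m f)    ≡⟨ cong parity (inversionsOn-cong val (words m) f≗g) ⟩
  parity (inversions m g)    ≡⟨ signPerm≡parity m g ⟨
  signPerm m g               ∎
  where open ≡-Reasoning

signPerm-id : ∀ m → signPerm m id ≡ Sign.+
signPerm-id m = trans (signPerm≡parity m id) (cong parity (inversionsOn-id val (words m)))

signPerm-∘ : ∀ m {f g} → Permutes (words m) f → Permutes (words m) g →
             signPerm m (g ∘ f) ≡ signPerm m f Sign.* signPerm m g
signPerm-∘ m {f} {g} f-perm g-perm = begin
  signPerm m (g ∘ f)                                   ≡⟨ signPerm≡parity m (g ∘ f) ⟩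
  parity (inversions m (g ∘ f))                        ≡⟨ WordParity.parity-inversionsOn-∘ m f-perm g-perm ⟩
  parity (inversions m f) Sign.* parity (inversions m g) ≡⟨ cong₂ Sign._*_ (signPerm≡parity m f) (signPerm≡parity m g) ⟨
  signPerm m f Sign.* signPerm m g                     ∎
  where open ≡-Reasoning

length-preserving-bijection-permutes : ∀ m {f : Word → Word} →
  (∀ {x y} → f x ≡ f y → x ≡ y) → (∀ y → ∃ λ x → f x ≡ y) → (∀ x → length (f x) ≡ length x) →
  Permutes (words m) f
length-preserving-bijection-permutes m {f} f-injective f-surjective f-length = record
  { injective   = f-injective
  ; ∈-preserved = λ {x} x∈words → ∈-words⁺ m (trans (f-length x) (∈-words⁻ m x∈words))
  ; onto        = onto
  }
  where
  onto : ∀ {y} → y ∈ words m → ∃ λ x → x ∈ words m × f x ≡ y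
  onto {y} y∈words with f-surjective y
  ... | x , refl = x , ∈-words⁺ m (trans (sym (f-length x)) (∈-words⁻ m y∈words)) , refl

PreservesChildren : (Word → Word) → Set
PreservesChildren φ = ∀ w b → ∃ λ b′ → φ (w ++ [ b ]) ≡ φ w ++ [ b′ ]

children-∘ : ∀ {φ ψ} → PreservesChildren φ → PreservesChildren ψ → PreservesChildren (φ ∘ ψ)
children-∘ {φ} {ψ} φ-children ψ-children w b with ψ-children w b
... | b′ , eq with φ-children (ψ w) b′
... | b″ , eq′ = b″ , trans (cong φ eq) eq′

inverse-child : ∀ {φ ψ : Word → Word} → ψ ∘ φ ≗ id → φ ∘ ψ ≗ id →
                ∀ {w x c} → φ (ψ w ++ [ x ]) ≡ φ (ψ w) ++ [ c ] → ψ (w ++ [ c ]) ≡ ψ w ++ [ x ]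
inverse-child {φ} {ψ} ψ∘φ≗id φ∘ψ≗id {w} {x} {c} eq = begin
  ψ (w ++ [ c ])             ≡⟨ cong (λ u → ψ (u ++ [ c ])) (φ∘ψ≗id w) ⟨
  ψ (φ (ψ w) ++ [ c ])       ≡⟨ cong ψ eq ⟨
  ψ (φ (ψ w ++ [ x ]))       ≡⟨ ψ∘φ≗id _ ⟩
  ψ w ++ [ x ]               ∎
  where open ≡-Reasoning

children-from-images : ∀ {ψ : Word → Word} {w c₀ c₁} →
  ψ (w ++ [ c₀ ]) ≡ ψ w ++ [ false ] → ψ (w ++ [ c₁ ]) ≡ ψ w ++ [ true ] →
  ∀ b → ∃ λ b′ → ψ (w ++ [ b ]) ≡ ψ w ++ [ b′ ]
children-from-images {ψ} {w} {c₀} {c₁} e₀ e₁ b with b Bool.≟ c₀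
... | yes refl = false , e₀
... | no b≢c₀ = true , subst (λ c → ψ (w ++ [ c ]) ≡ ψ w ++ [ true ]) (trans (¬-not c₁≢c₀) (sym (¬-not b≢c₀))) e₁
  where
  c₁≢c₀ : c₁ ≢ c₀
  c₁≢c₀ refl with () ← ++-cancelˡ (ψ w) _ _ (trans (sym e₁) e₀)

inverse-preserves-children : ∀ {φ ψ : Word → Word} → ψ ∘ φ ≗ id → φ ∘ ψ ≗ id →
                             PreservesChildren φ → PreservesChildren ψ
inverse-preserves-children {φ} {ψ} ψ∘φ≗id φ∘ψ≗id φ-children w
  with φ-children (ψ w) false | φ-children (ψ w) true
... | _ , eq₀ | _ , eq₁ =
  children-from-images {ψ} (inverse-child {φ} ψ∘φ≗id φ∘ψ≗id eq₀) (inverse-child {φ} ψ∘φ≗id φ∘ψ≗id eq₁)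

children⇒child : ∀ {φ} → PreservesChildren φ → ∀ {u v} → Child u v → Child (φ u) (φ v)
children⇒child φ-children (b , refl) = φ-children _ b

children⇒prefixes : ∀ {φ} → PreservesChildren φ →
                    ∀ w s → ∃ λ s′ → φ (w ++ s) ≡ φ w ++ s′ × length s′ ≡ length s
children⇒prefixes {φ} φ-children w [] =
  [] , trans (cong φ (++-identityʳ w)) (sym (++-identityʳ (φ w))) , refl
children⇒prefixes {φ} φ-children w (b ∷ s)
  with φ-children w b | children⇒prefixes φ-children (w ++ [ b ]) s
... | b′ , eq | s′ , eq′ , length-s′ = b′ ∷ s′ , extends , cong suc length-s′
  where
  open ≡-Reasoning
  extends : φ (w ++ b ∷ s) ≡ φ w ++ b′ ∷ s′
  extends = begin
    φ (w ++ b ∷ s)              ≡⟨ cong φ (++-assoc w [ b ] s) ⟨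
    φ ((w ++ [ b ]) ++ s)       ≡⟨ eq′ ⟩
    φ (w ++ [ b ]) ++ s′        ≡⟨ cong (_++ s′) eq ⟩
    (φ w ++ [ b′ ]) ++ s′       ≡⟨ ++-assoc (φ w) [ b′ ] s′ ⟩
    φ w ++ b′ ∷ s′              ∎

fun-children : ∀ ρ → PreservesChildren (fun ρ)
fun-children ρ w b = fun-child ρ (w ++ [ b ]) w (b , refl)

fun-length : ∀ ρ w → length (fun ρ w) ≡ length w
fun-length ρ w with children⇒prefixes (fun-children ρ) [] w
... | s′ , eq , length-s′ = trans (cong length (trans eq (cong (_++ s′) (fun-root ρ)))) length-s′

fun-injective : ∀ ρ {v w} → fun ρ v ≡ fun ρ w → v ≡ w
fun-injective ρ {v} {w} eq = trans (sym (inv-fun ρ v)) (trans (cong (inv ρ) eq) (inv-fun ρ w))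

local : Aut → Word → Word → Word
local ρ w s = drop (length w) (fun ρ (w ++ s))

drop-length-++ : ∀ (xs ys : List A) → drop (length xs) (xs ++ ys) ≡ ys
drop-length-++ []       ys = refl
drop-length-++ (x ∷ xs) ys = drop-length-++ xs ys

fun-++ : ∀ ρ w s → fun ρ (w ++ s) ≡ fun ρ w ++ local ρ w s
fun-++ ρ w s with children⇒prefixes (fun-children ρ) w s
... | s′ , eq , _ = begin
  fun ρ (w ++ s)                                       ≡⟨ eq ⟩
  fun ρ w ++ s′                                        ≡⟨ cong (fun ρ w ++_) (drop-length-++ (fun ρ w) s′) ⟨
  fun ρ w ++ drop (length (fun ρ w)) (fun ρ w ++ s′)   ≡⟨ cong (λ n → fun ρ w ++ drop n (fun ρ w ++ s′)) (fun-length ρ w) ⟩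
  fun ρ w ++ drop (length w) (fun ρ w ++ s′)           ≡⟨ cong (λ u → fun ρ w ++ drop (length w) u) eq ⟨
  fun ρ w ++ local ρ w s                               ∎
  where open ≡-Reasoning

local-length : ∀ ρ w s → length (local ρ w s) ≡ length s
local-length ρ w s = +-cancelˡ-≡ (length w) _ _ (begin
  length w + length (local ρ w s)           ≡⟨ cong (_+ length (local ρ w s)) (fun-length ρ w) ⟨
  length (fun ρ w) + length (local ρ w s)   ≡⟨ length-++ (fun ρ w) ⟨
  length (fun ρ w ++ local ρ w s)           ≡⟨ cong length (fun-++ ρ w s) ⟨
  length (fun ρ (w ++ s))                   ≡⟨ fun-length ρ (w ++ s) ⟩
  length (w ++ s)                           ≡⟨ length-++ w ⟩
  length w + length s                       ∎)
  where open ≡-Reasoning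

local-injective : ∀ ρ w {s t} → local ρ w s ≡ local ρ w t → s ≡ t
local-injective ρ w {s} {t} eq = ++-cancelˡ w s t (fun-injective ρ (begin
  fun ρ (w ++ s)            ≡⟨ fun-++ ρ w s ⟩
  fun ρ w ++ local ρ w s    ≡⟨ cong (fun ρ w ++_) eq ⟩
  fun ρ w ++ local ρ w t    ≡⟨ fun-++ ρ w t ⟨
  fun ρ (w ++ t)            ∎))
  where open ≡-Reasoning

local-surjective : ∀ ρ w t → ∃ λ s → local ρ w s ≡ t
local-surjective ρ w t = s , ++-cancelˡ (fun ρ w) _ _ (begin
  fun ρ w ++ local ρ w s          ≡⟨ fun-++ ρ w s ⟨
  fun ρ (w ++ s)                  ≡⟨ cong (λ u → fun ρ (u ++ s)) (inv-fun ρ w) ⟨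
  fun ρ (inv ρ (fun ρ w) ++ s)    ≡⟨ cong (fun ρ) (fun-++ (ρ ⁻¹ᴬ) (fun ρ w) t) ⟨
  fun ρ (inv ρ (fun ρ w ++ t))    ≡⟨ fun-inv ρ _ ⟩
  fun ρ w ++ t                    ∎)
  where
  open ≡-Reasoning
  s : Word
  s = local (ρ ⁻¹ᴬ) (fun ρ w) t

local-permutes : ∀ m ρ w → Permutes (words m) (local ρ w)
local-permutes m ρ w =
  length-preserving-bijection-permutes m (local-injective ρ w) (local-surjective ρ w) (local-length ρ w)

local-∘ᴬ : ∀ ρ π w → local (ρ ∘ᴬ π) w ≗ local ρ (fun π w) ∘ local π w
local-∘ᴬ ρ π w s = ++-cancelˡ (fun ρ (fun π w)) _ _ (begin
  fun ρ (fun π w) ++ local (ρ ∘ᴬ π) w s              ≡⟨ fun-++ (ρ ∘ᴬ π) w s ⟨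
  fun ρ (fun π (w ++ s))                              ≡⟨ cong (fun ρ) (fun-++ π w s) ⟩
  fun ρ (fun π w ++ local π w s)                      ≡⟨ fun-++ ρ (fun π w) (local π w s) ⟩
  fun ρ (fun π w) ++ local ρ (fun π w) (local π w s)  ∎)
  where open ≡-Reasoning

local-cong : ∀ {ρ π} → fun ρ ≗ fun π → ∀ w → local ρ w ≗ local π w
local-cong ρ≗π w s = cong (drop (length w)) (ρ≗π (w ++ s))

local-trivial : ∀ {ρ} → fun ρ ≗ id → ∀ w → local ρ w ≗ id
local-trivial {ρ} ρ≗id w s = ++-cancelˡ w _ _ (begin
  w ++ local ρ w s          ≡⟨ cong (_++ local ρ w s) (ρ≗id w) ⟨
  fun ρ w ++ local ρ w s    ≡⟨ fun-++ ρ w s ⟨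
  fun ρ (w ++ s)            ≡⟨ ρ≗id (w ++ s) ⟩
  w ++ s                    ∎)
  where open ≡-Reasoning

length-zero : ∀ {x : Word} → length x ≡ 0 → x ≡ []
length-zero {[]} _ = refl

module _ (L : Labeling) where

  lab-children : PreservesChildren (lab L)
  lab-children = lab-child L

  unlab-children : PreservesChildren (unlab L)
  unlab-children = inverse-preserves-children {lab L} (unlab-lab L) (lab-unlab L) lab-children

  lab-root : lab L root ≡ []
  lab-root = length-zero (lab-level L root)

  unlab-root : unlab L [] ≡ root
  unlab-root = length-zero (trans (sym (lab-level L (unlab L []))) (cong length (lab-unlab L [])))

  relabelled-children : ∀ σ → PreservesChildren (lab L ∘ fun σ ∘ unlab L)
  relabelled-children σ = children-∘ lab-children (children-∘ (fun-children σ) unlab-children)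

  relabel : Aut → Aut
  relabel σ = record
    { fun       = lab L ∘ fun σ ∘ unlab L
    ; inv       = lab L ∘ inv σ ∘ unlab L
    ; inv-fun   = λ w → trans (cong (lab L ∘ inv σ) (unlab-lab L _))
                              (trans (cong (lab L) (inv-fun σ (unlab L w))) (lab-unlab L w))
    ; fun-inv   = λ w → trans (cong (lab L ∘ fun σ) (unlab-lab L _))
                              (trans (cong (lab L) (fun-inv σ (unlab L w))) (lab-unlab L w))
    ; fun-root  = trans (cong (lab L ∘ fun σ) unlab-root) (trans (cong (lab L) (fun-root σ)) lab-root)
    ; fun-child = λ u v → children⇒child (relabelled-children σ)
    ; inv-child = λ u v → children⇒child (relabelled-children (σ ⁻¹ᴬ))
    }

  relabel-∘ᴬ : ∀ σ τ → fun (relabel (σ ∘ᴬ τ)) ≗ fun (relabel σ ∘ᴬ relabel τ)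
  relabel-∘ᴬ σ τ w = cong (lab L ∘ fun σ) (sym (unlab-lab L (fun τ (unlab L w))))

  relabel-trivial : ∀ {ρ} → fun ρ ≗ id → fun (relabel ρ) ≗ id
  relabel-trivial ρ≗id w = trans (cong (lab L) (ρ≗id (unlab L w))) (lab-unlab L w)

  sgn-local : ∀ m σ y → sgn L m σ y ≡ signPerm m (local (relabel σ) (lab L y))
  sgn-local m σ y =
    cong (λ n → signPerm m (λ s → drop n (lab L (fun σ (unlab L (lab L y ++ s)))))) (sym (lab-level L y))

  sgn-∘ᴬ : ∀ m σ τ y → sgn L m (σ ∘ᴬ τ) y ≡ sgn L m τ y Sign.* sgn L m σ (fun τ y)
  sgn-∘ᴬ m σ τ y = begin
    sgn L m (σ ∘ᴬ τ) y
      ≡⟨ sgn-local m (σ ∘ᴬ τ) y ⟩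
    signPerm m (local (relabel (σ ∘ᴬ τ)) w)
      ≡⟨ signPerm-cong m (λ s → trans (local-cong {relabel (σ ∘ᴬ τ)} {σ′ ∘ᴬ τ′} (relabel-∘ᴬ σ τ) w s) (local-∘ᴬ σ′ τ′ w s)) ⟩
    signPerm m (local σ′ (fun τ′ w) ∘ local τ′ w)
      ≡⟨ signPerm-∘ m (local-permutes m τ′ w) (local-permutes m σ′ (fun τ′ w)) ⟩
    signPerm m (local τ′ w) Sign.* signPerm m (local σ′ (fun τ′ w))
      ≡⟨ cong (λ u → signPerm m (local τ′ w) Sign.* signPerm m (local σ′ (lab L (fun τ u)))) (unlab-lab L y) ⟩
    signPerm m (local τ′ w) Sign.* signPerm m (local σ′ (lab L (fun τ y)))
      ≡⟨ cong₂ Sign._*_ (sgn-local m τ y) (sgn-local m σ (fun τ y)) ⟨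
    sgn L m τ y Sign.* sgn L m σ (fun τ y)
      ∎
    where
    open ≡-Reasoning
    w : Word
    w = lab L y
    σ′ τ′ : Aut
    σ′ = relabel σ
    τ′ = relabel τ

  sgn-trivial : ∀ m {ρ} y → fun ρ ≗ id → sgn L m ρ y ≡ Sign.+
  sgn-trivial m {ρ} y ρ≗id = begin
    sgn L m ρ y                               ≡⟨ sgn-local m ρ y ⟩
    signPerm m (local (relabel ρ) (lab L y))  ≡⟨ signPerm-cong m (local-trivial {relabel ρ} (relabel-trivial {ρ} ρ≗id) (lab L y)) ⟩
    signPerm m id                             ≡⟨ signPerm-id m ⟩
    Sign.+                                    ∎
    where open ≡-Reasoning

  sgn-⁻¹ᴬ : ∀ m σ y → sgn L m (σ ⁻¹ᴬ) y ≡ sgn L m σ (inv σ y)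
  sgn-⁻¹ᴬ m σ y = Signₚ.*-cancelʳ-≡ (sgn L m σ (inv σ y)) _ _ (begin
    sgn L m (σ ⁻¹ᴬ) y Sign.* sgn L m σ (inv σ y)  ≡⟨ sgn-∘ᴬ m σ (σ ⁻¹ᴬ) y ⟨
    sgn L m (σ ∘ᴬ (σ ⁻¹ᴬ)) y                      ≡⟨ sgn-trivial m {σ ∘ᴬ (σ ⁻¹ᴬ)} y (fun-inv σ) ⟩
    Sign.+                                        ≡⟨ Signₚ.s*s≡+ (sgn L m σ (inv σ y)) ⟨
    sgn L m σ (inv σ y) Sign.* sgn L m σ (inv σ y) ∎)
    where open ≡-Reasoning

module _ (L : Labeling) (ℓ : ℕ) where

  sgn-idAut : ∀ y → sgn L ℓ idAut y ≡ Sign.+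
  sgn-idAut y = sgn-trivial L ℓ {idAut} y (λ _ → refl)

  sgn-∘ᴬ-Mtilde : ∀ σ τ → InMtilde L ℓ σ → InMtilde L ℓ τ →
                  ∀ y → sgn L ℓ (σ ∘ᴬ τ) y ≡ sgn L ℓ τ root Sign.* sgn L ℓ σ root
  sgn-∘ᴬ-Mtilde σ τ σ∈M̃ τ∈M̃ y = trans (sgn-∘ᴬ L ℓ σ τ y) (cong₂ Sign._*_ (τ∈M̃ y) (σ∈M̃ (fun τ y)))

  sgn-⁻¹ᴬ-Mtilde : ∀ σ → InMtilde L ℓ σ → ∀ y → sgn L ℓ (σ ⁻¹ᴬ) y ≡ sgn L ℓ σ root
  sgn-⁻¹ᴬ-Mtilde σ σ∈M̃ y = trans (sgn-⁻¹ᴬ L ℓ σ y) (σ∈M̃ (inv σ y))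

  Mtilde-idAut : InMtilde L ℓ idAut
  Mtilde-idAut y = trans (sgn-idAut y) (sym (sgn-idAut root))

  Mtilde-∘ᴬ : ∀ σ τ → InMtilde L ℓ σ → InMtilde L ℓ τ → InMtilde L ℓ (σ ∘ᴬ τ)
  Mtilde-∘ᴬ σ τ σ∈M̃ τ∈M̃ y = trans (sgn-∘ᴬ-Mtilde σ τ σ∈M̃ τ∈M̃ y) (sym (sgn-∘ᴬ-Mtilde σ τ σ∈M̃ τ∈M̃ root))

  Mtilde-⁻¹ᴬ : ∀ σ → InMtilde L ℓ σ → InMtilde L ℓ (σ ⁻¹ᴬ)
  Mtilde-⁻¹ᴬ σ σ∈M̃ y = trans (sgn-⁻¹ᴬ-Mtilde σ σ∈M̃ y) (sym (sgn-⁻¹ᴬ-Mtilde σ σ∈M̃ root))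

  Mtilde-isSubgroup : IsSubgroup (InMtilde L ℓ)
  Mtilde-isSubgroup = Mtilde-idAut , Mtilde-∘ᴬ , Mtilde-⁻¹ᴬ

  M-isSubgroup : IsSubgroup (InM L ℓ)
  M-isSubgroup = (Mtilde-idAut , sgn-idAut root) , M-∘ᴬ , M-⁻¹ᴬ
    where
    M-∘ᴬ : ∀ σ τ → InM L ℓ σ → InM L ℓ τ → InM L ℓ (σ ∘ᴬ τ)
    M-∘ᴬ σ τ (σ∈M̃ , σ⁺) (τ∈M̃ , τ⁺) =
      Mtilde-∘ᴬ σ τ σ∈M̃ τ∈M̃ , trans (sgn-∘ᴬ-Mtilde σ τ σ∈M̃ τ∈M̃ root) (cong₂ Sign._*_ τ⁺ σ⁺)
    M-⁻¹ᴬ : ∀ σ → InM L ℓ σ → InM L ℓ (σ ⁻¹ᴬ)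
    M-⁻¹ᴬ σ (σ∈M̃ , σ⁺) = Mtilde-⁻¹ᴬ σ σ∈M̃ , trans (sgn-⁻¹ᴬ-Mtilde σ σ∈M̃ root) σ⁺

theorem2p3 : (L : Labeling) (ℓ : ℕ) → ℓ ≥ 2 →
    IsSubgroup (InMtilde L ℓ) × IsSubgroup (InM L ℓ)
theorem2p3 L ℓ _ = Mtilde-isSubgroup L ℓ , M-isSubgroup L ℓ
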